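{- For every integer $k\ge 0$, $k_L=k\cdot 1_L$ (partizan equality).
   Context: An $N$-player partizan game ($N\ge2$) is an ordered $N$-tuple $(\mathscr G^{C_0},\dots,\mathscr G^{C_{N-1}})$ of finite sets of partizan games (no infinite runs); players Left $=C_0$, $C_1,\dots,C_{N-2}$, Right $=C_{N-1}$ move cyclically, $\mathscr G^{C_i}$ being the options for $C_i$. Under normal play, a player with no option on their turn is the unique loser and all others win. $0$ is the game with no options. The disjunctive sum $G+H$ has $C_i$-options $G^{C_i}+H$ and $G+H^{C_i}$; $k\cdot G$ is the sum of $k$ copies of $G$. $1_L$ is the game whose only option is a Left option to $0$; $0_L=0$ and $k_L$ is the game whose Left options are $0,1_L,2_L,\dots,(k-1)_L$ and which has no options for other players. Equality $G=H$ means: for every game $X$ and every choice of first player, the set of players that can guarantee not losing in $G+X$ equals that in $H+X$. -}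

module Defs where

open import Data.Nat using (ℕ; zero; suc)
open import Data.Fin using (Fin; zero; suc)
open import Data.List using (List; []; _∷_; _++_)
open import Data.List.Membership.Propositional using (_∈_)
open import Data.List.Relation.Unary.All using (All)
open import Relation.Binary.PropositionalEquality using (_≢_)
open import Function.Bundles using (_⇔_)

-- An N-player partizan game: for each player C_i (i : Fin N) a finite
-- (list-represented) collection of options. Player 0 is Left, player N-1 is Right.
data Game (N : ℕ) : Set where
  mk : (Fin N → List (Game N)) → Game N

opts : ∀ {N} → Game N → Fin N → List (Game N)
opts (mk f) = f

zeroG : ∀ {N} → Game N
zeroG = mk (λ _ → [])

leftOnly : ∀ {m} → List (Game (suc m)) → Game (suc m)
leftOnly {m} xs = mk f
  where
  f : Fin (suc m) → List (Game (suc m))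
  f zero    = xs
  f (suc _) = []

oneL : ∀ {m} → Game (suc m)
oneL = leftOnly (zeroG ∷ [])

mutual
  kL : ∀ {m} → ℕ → Game (suc m)
  kL k = leftOnly (below k)

  below : ∀ {m} → ℕ → List (Game (suc m))
  below zero    = []
  below (suc k) = below k ++ (kL k ∷ [])

mutual
  _⊕_ : ∀ {N} → Game N → Game N → Game N
  mk f ⊕ mk g = mk (λ i → sumL (f i) (mk g) ++ sumR (mk f) (g i))

  sumL : ∀ {N} → List (Game N) → Game N → List (Game N)
  sumL []       H = []
  sumL (G ∷ Gs) H = (G ⊕ H) ∷ sumL Gs H

  sumR : ∀ {N} → Game N → List (Game N) → List (Game N)
  sumR G []       = []
  sumR G (H ∷ Hs) = (G ⊕ H) ∷ sumR G Hs

infixl 6 _⊕_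

_·_ : ∀ {N} → ℕ → Game N → Game N
zero  · G = zeroG
suc k · G = G ⊕ (k · G)

-- cyclic successor of players: C_i ↦ C_{i+1 mod N}
next : ∀ {m} → Fin (suc m) → Fin (suc m)
next {zero}  zero    = zero
next {suc m} zero    = suc zero
next {suc m} (suc i) with next {m} i
... | zero  = zero
... | suc j = suc (suc j)

-- Avoid p t G : in game G with player t to move (play cyclic), player p
-- can guarantee not to be the (unique) loser, i.e. not to be the player
-- to move when no option is available.
data Avoid {m : ℕ} (p : Fin (suc m)) : Fin (suc m) → Game (suc m) → Set where
  own   : ∀ {f G} → G ∈ f p → Avoid p (next p) G → Avoid p p (mk f)
  other : ∀ {t f} → t ≢ p → All (Avoid p (next t)) (f t) → Avoid p t (mk f)

_≈G_ : ∀ {m} → Game (suc m) → Game (suc m) → Set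
_≈G_ {m} G H = (X : Game (suc m)) (first p : Fin (suc m)) →
  Avoid p first (G ⊕ X) ⇔ Avoid p first (H ⊕ X)

module Submission where

-- Call G a Left-only game of height a when no player but Left
-- ever has a move in G, and the longest run of Left moves in G has length a.
-- Both k_L and k·1_L are Left-only of height k, so the theorem follows from
-- a general fact: Left-only games of equal height are equal.
--
-- That fact is a monotonicity principle (replace): in G + X, replacing G of
-- height a by H of height b, with a ≤ b when the observing player is Left and
-- b ≤ a otherwise, preserves every "player p avoids losing" statement.  Its
-- proof is a simultaneous induction on G (through its height certificate) and
-- on X: moves in X are answered by the same move in X, and a Left move
-- G → G' of height a' < a ≤ b is answered by a move H → H' of height b - 1,
-- which again lies on the favourable side of a'.

open import Defs
open import Data.Nat using (ℕ; zero; suc; _+_; _*_; _≤_; _<_)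
open import Data.Nat.Properties using (≤-refl; <-≤-trans; <⇒≤pred; m<n⇒m<1+n; +-monoˡ-<; +-monoʳ-<; *-identityʳ)
open import Data.Fin using (Fin; zero; suc)
open import Data.List using (List; []; _∷_; _++_)
open import Data.List.Membership.Propositional using (_∈_; find; lose)
open import Data.List.Relation.Unary.All using (All; []; _∷_)
import Data.List.Relation.Unary.All as All
import Data.List.Relation.Unary.All.Properties as AllP
open import Data.List.Relation.Unary.Any using (Any; here; there)
import Data.List.Relation.Unary.Any.Properties as AnyP
open import Data.Product using (_,_)
open import Data.Sum using ([_,_])
open import Function using (_∘_)
open import Relation.Binary.PropositionalEquality using (_≡_; _≢_; refl; sym; subst)
open import Function.Bundles using (mk⇔)

data Height {m : ℕ} : ℕ → Game (suc m) → Set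
data Lower {m : ℕ} (a : ℕ) (G : Game (suc m)) : Set
data Reaches {m : ℕ} : ℕ → List (Game (suc m)) → Set

data Height {m} where
  height : ∀ {a f} → (∀ i → f (suc i) ≡ []) → All (Lower a) (f zero) → Reaches a (f zero) →
           Height a (mk f)

data Lower {m} a G where
  lower : ∀ {a'} → a' < a → Height a' G → Lower a G

data Reaches {m} where
  reaches-zero : ∀ {xs} → Reaches zero xs
  reaches-suc  : ∀ {a xs} → Any (Height a) xs → Reaches (suc a) xs

sumL-∈ : ∀ {N} {G : Game N} {Gs H} → G ∈ Gs → (G ⊕ H) ∈ sumL Gs H
sumL-∈ (here refl) = here refl
sumL-∈ (there G∈) = there (sumL-∈ G∈)

height-zero : ∀ {m} → Height {m} 0 zeroG
height-zero = height (λ _ → refl) [] reaches-zero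

height-oneL : ∀ {m} → Height {m} 1 oneL
height-oneL = height (λ _ → refl) (lower ≤-refl height-zero ∷ []) (reaches-suc (here height-zero))

height-kL : ∀ {m} k → Height {m} k (kL k)
lower-below : ∀ {m} k → All (Lower k) (below {m} k)
reaches-below : ∀ {m} k → Reaches k (below {m} k)

height-kL k = height (λ _ → refl) (lower-below k) (reaches-below k)

lower-below zero = []
lower-below (suc k) = AllP.++⁺ (All.map raise (lower-below k)) (lower ≤-refl (height-kL k) ∷ [])
  where
  raise : ∀ {G} → Lower k G → Lower (suc k) G
  raise (lower a'<k hG) = lower (m<n⇒m<1+n a'<k) hG

reaches-below zero = reaches-zero
reaches-below (suc k) = reaches-suc (AnyP.++⁺ʳ (below k) (here (height-kL k)))

-- Heights add under disjunctive sum: a longest Left run in G + H is a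
-- longest run in G followed by a longest run in H.
height-⊕ : ∀ {m a b} {G H : Game (suc m)} → Height a G → Height b H → Height (a + b) (G ⊕ H)
lower-sumL : ∀ {m a b} {Gs} {H : Game (suc m)} → All (Lower a) Gs → Height b H → All (Lower (a + b)) (sumL Gs H)
lower-sumR : ∀ {m a b} {Hs} {G : Game (suc m)} → Height a G → All (Lower b) Hs → All (Lower (a + b)) (sumR G Hs)
tallest-sumL : ∀ {m a b} {Gs} {H : Game (suc m)} → Any (Height a) Gs → Height b H → Any (Height (a + b)) (sumL Gs H)
tallest-sumR : ∀ {m a b} {Hs} {G : Game (suc m)} → Height a G → Any (Height b) Hs → Any (Height (a + b)) (sumR G Hs)

height-⊕ {a = a} {b} {mk f} {mk g} hG@(height noF lowF reachF) hH@(height noG lowG reachG) =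
  height noOthers (AllP.++⁺ (lower-sumL lowF hH) (lower-sumR hG lowG)) (reaches reachF reachG)
  where
  noOthers : ∀ i → sumL (f (suc i)) (mk g) ++ sumR (mk f) (g (suc i)) ≡ []
  noOthers i rewrite noF i | noG i = refl

  reaches : Reaches a (f zero) → Reaches b (g zero) →
            Reaches (a + b) (sumL (f zero) (mk g) ++ sumR (mk f) (g zero))
  reaches (reaches-suc tallF) _ = reaches-suc (AnyP.++⁺ˡ (tallest-sumL tallF hH))
  reaches reaches-zero reaches-zero = reaches-zero
  reaches reaches-zero (reaches-suc tallG) =
    reaches-suc (AnyP.++⁺ʳ (sumL (f zero) (mk g)) (tallest-sumR hG tallG))

lower-sumL [] _ = []
lower-sumL {b = b} (lower a'<a hG' ∷ lows) hH = lower (+-monoˡ-< b a'<a) (height-⊕ hG' hH) ∷ lower-sumL lows hH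

lower-sumR _ [] = []
lower-sumR {a = a} hG (lower b'<b hH' ∷ lows) = lower (+-monoʳ-< a b'<b) (height-⊕ hG hH') ∷ lower-sumR hG lows

tallest-sumL (here hG') hH = here (height-⊕ hG' hH)
tallest-sumL (there tall) hH = there (tallest-sumL tall hH)

tallest-sumR hG (here hH') = here (height-⊕ hG hH')
tallest-sumR hG (there tall) = there (tallest-sumR hG tall)

height-· : ∀ {m a} {G : Game (suc m)} k → Height a G → Height (k * a) (k · G)
height-· zero _ = height-zero
height-· (suc k) hG = height-⊕ hG (height-· k hG)

-- Favours p a b: replacing a Left-only summand of height a by one of height b
-- can only help player p (Left profits from more Left moves, the others from fewer).
Favours : ∀ {m} → Fin (suc m) → ℕ → ℕ → Set
Favours zero a b = a ≤ b
Favours (suc _) a b = b ≤ a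

favours-refl : ∀ {m} (p : Fin (suc m)) a → Favours p a a
favours-refl zero _ = ≤-refl
favours-refl (suc _) _ = ≤-refl

any-++-map : ∀ {A : Set} {P Q : A → Set} xs {ys xs' ys'} →
  (Any P xs → Any Q xs') → (Any P ys → Any Q ys') → Any P (xs ++ ys) → Any Q (xs' ++ ys')
any-++-map xs {xs' = xs'} onL onR = [ AnyP.++⁺ˡ ∘ onL , AnyP.++⁺ʳ xs' ∘ onR ] ∘ AnyP.++⁻ xs

all-++-map : ∀ {A : Set} {P Q : A → Set} xs {ys xs' ys'} →
  (All P xs → All Q xs') → (All P ys → All Q ys') → All P (xs ++ ys) → All Q (xs' ++ ys')
all-++-map xs onL onR all = AllP.++⁺ (onL (AllP.++⁻ˡ xs all)) (onR (AllP.++⁻ʳ xs all))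

own-move : ∀ {m} {p : Fin (suc m)} {f} → Any (Avoid p (next p)) (f p) → Avoid p p (mk f)
own-move moves with find moves
... | _ , Y∈ , av = own Y∈ av

-- It is proved together with the helpers below by
-- simultaneous structural recursion on the height certificate of G and on X:
-- positions G' + X shrink the certificate, positions G + X' shrink X.
replace : ∀ {m a b} {p t : Fin (suc m)} {G H X} → Height a G → Height b H → Favours p a b →
  Avoid p t (G ⊕ X) → Avoid p t (H ⊕ X)

-- Left chooses some option G' + X: answer with an option H' of height b - 1 ≥ a'.
left-answer : ∀ {m a b} {s : Fin (suc m)} {Gs Hs X} → All (Lower a) Gs → Reaches b Hs → a ≤ b →
  Any (Avoid zero s) (sumL Gs X) → Any (Avoid zero s) (sumL Hs X)
left-answer (lower a'<a hG' ∷ _) (reaches-suc tallH) a≤b (here av) with find tallH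
... | H' , H'∈ , hH' = lose (sumL-∈ H'∈) (replace hG' hH' (<⇒≤pred (<-≤-trans a'<a a≤b)) av)
left-answer (lower a'<a _ ∷ _) reaches-zero a≤b (here _) with () ← <-≤-trans a'<a a≤b
left-answer (_ ∷ lows) reachH a≤b (there moves) = left-answer lows reachH a≤b moves

taller-option : ∀ {m b' c} {i : Fin m} {s} {Gs H' X} → Any (Height c) Gs → Height b' H' → b' ≤ c →
  All (Avoid (suc i) s) (sumL Gs X) → Avoid (suc i) s (H' ⊕ X)
taller-option (here hG') hH' b'≤c (av ∷ _) = replace hG' hH' b'≤c av
taller-option (there tall) hH' b'≤c (_ ∷ avs) = taller-option tall hH' b'≤c avs

-- Left's option H' + X (height b' < b ≤ a) is met by an option G' of height a - 1 ≥ b'.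
left-threat : ∀ {m a b} {i : Fin m} {s} {Gs Hs X} → All (Lower b) Hs → Reaches a Gs → b ≤ a →
  All (Avoid (suc i) s) (sumL Gs X) → All (Avoid (suc i) s) (sumL Hs X)
left-threat [] _ _ _ = []
left-threat (lower b'<b _ ∷ _) reaches-zero b≤a _ with () ← <-≤-trans b'<b b≤a
left-threat (lower b'<b hH' ∷ lows) (reaches-suc tallG) b≤a avs =
  taller-option tallG hH' (<⇒≤pred (<-≤-trans b'<b b≤a)) avs ∷ left-threat lows (reaches-suc tallG) b≤a avs

own-summand : ∀ {m a b} (p : Fin (suc m)) {s G H X} → Height a G → Height b H → Favours p a b →
  Any (Avoid p s) (sumL (opts G p) X) → Any (Avoid p s) (sumL (opts H p) X)
own-summand zero (height _ lowG _) (height _ _ reachH) a≤b = left-answer lowG reachH a≤b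
own-summand (suc i) {s = s} {X = X} (height noG _ _) _ _ moves
  with () ← AnyP.¬Any[] (subst (λ l → Any (Avoid (suc i) s) (sumL l X)) (noG i) moves)

other-summand : ∀ {m a b} {p : Fin (suc m)} (t : Fin (suc m)) {s G H X} → t ≢ p →
  Height a G → Height b H → Favours p a b →
  All (Avoid p s) (sumL (opts G t) X) → All (Avoid p s) (sumL (opts H t) X)
other-summand {p = zero} zero t≢p _ _ _ _ with () ← t≢p refl
other-summand {p = suc _} zero _ (height _ _ reachG) (height _ lowH _) b≤a = left-threat lowH reachG b≤a
other-summand (suc j) {s = s} {X = X} _ _ (height noH _ _) _ _ =
  subst (λ l → All (Avoid _ s) (sumL l X)) (sym (noH j)) []

-- Moves inside X are answered by the same move: G + X' is replaced by H + X'.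
mirror-any : ∀ {m a b} {p s : Fin (suc m)} {G H} → Height a G → Height b H → Favours p a b →
  (Xs : List (Game (suc m))) → Any (Avoid p s) (sumR G Xs) → Any (Avoid p s) (sumR H Xs)
mirror-any hG hH fav (_ ∷ _) (here av) = here (replace hG hH fav av)
mirror-any hG hH fav (_ ∷ Xs) (there moves) = there (mirror-any hG hH fav Xs moves)

mirror-all : ∀ {m a b} {p s : Fin (suc m)} {G H} → Height a G → Height b H → Favours p a b →
  (Xs : List (Game (suc m))) → All (Avoid p s) (sumR G Xs) → All (Avoid p s) (sumR H Xs)
mirror-all hG hH fav [] [] = []
mirror-all hG hH fav (_ ∷ Xs) (av ∷ avs) = replace hG hH fav av ∷ mirror-all hG hH fav Xs avs

replace {p = p} {G = mk f} {mk _} {mk g} hG hH fav (own Y∈ av) =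
  own-move (any-++-map (sumL (f p) (mk g))
             (own-summand p hG hH fav) (mirror-any hG hH fav (g p)) (lose Y∈ av))
replace {t = t} {G = mk f} {mk _} {mk g} hG hH fav (other t≢p avs) =
  other t≢p (all-++-map (sumL (f t) (mk g))
              (other-summand t t≢p hG hH fav) (mirror-all hG hH fav (g t)) avs)

height-equal : ∀ {m a} {G H : Game (suc m)} → Height a G → Height a H → G ≈G H
height-equal {a = a} hG hH X first p =
  mk⇔ (replace hG hH (favours-refl p a)) (replace hH hG (favours-refl p a))

mainTheorem17 : (n : ℕ) (k : ℕ) → kL {suc n} k ≈G (k · oneL {suc n})
mainTheorem17 n k = height-equal (height-kL k) k·1L-height
  where
  k·1L-height : Height k (k · oneL)
  k·1L-height = subst (λ c → Height c (k · oneL)) (*-identityʳ k) (height-· k height-oneL)
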